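{- Let $R$ be a cubiculated region. The set $\mathcal{T}_R$ of domino tilings of $R$ is flip connected if and only if $I_{R_{tiling}}\subseteq I_{R_{flip}}$.
   Context: A cubiculated region $R$ is an $n$-dimensional homogeneous cubical complex embedded in $\mathbb{R}^N$ whose elementary $n$-cubes are unit lattice cubes. A domino is a pair of elementary $n$-cubes sharing an $(n-1)$-face; a domino tiling is a set of dominoes covering each elementary cube exactly once; $\mathcal{T}_R$ is the set of tilings. $G_R$ has one vertex per elementary cube and an edge between cubes sharing an $(n-1)$-face; dominoes are edges of $G_R$. A move is an ordered pair $(D_1,D_2)$ of sets of dominoes, with $T+(D_1,D_2)=(T\setminus D_1)\cup D_2$. A (local) flip is the move replacing two adjacent parallel dominoes (sharing two $(n-1)$-faces, i.e. forming a $2\times 2$ square) by the two parallel dominoes in the perpendicular direction covering the same four cubes; $\mathcal{M}_{flip}$ is the set of all flip moves of $R$. $\mathcal{T}_R$ is flip connected if for all $T_1,T_2\in\mathcal{T}_R$ there are flips $M_1,\dots,M_r$ with $T_2=T_1+M_1+\dots+M_r$ and every intermediate $T_1+M_1+\dots+M_s$ a tiling. Over a field $\mathbb{K}$, in $\mathbb{K}[y_e:e\in E(G_R)]$ write $y^{E_0}=\prod_{e\in E_0}y_e$. The flip ideal is $I_{R_{flip}}=\langle y^{D_1}-y^{D_2}:(D_1,D_2)\in\mathcal{M}_{flip}\rangle$ and the tiling ideal is $I_{R_{tiling}}=\langle y^{T_1}-y^{T_2}:T_1,T_2\in\mathcal{T}_R\rangle$. -}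

module Defs where

open import Level using (Level; _⊔_) renaming (suc to lsuc)
open import Data.Bool using (Bool; true; false; if_then_else_)
open import Data.Nat as ℕ using (ℕ; zero; suc)
open import Data.Integer as ℤ using (ℤ)
open import Data.Fin as Fin using (Fin)
open import Data.Fin.Subset using (Subset; ∣_∣)
open import Data.Vec as Vec using (Vec; lookup; _[_]≔_; _[_]%=_; replicate; zipWith)
open import Data.Vec.Properties as VecP using ()
open import Data.Product using (Σ; ∃; ∃-syntax; _×_; _,_; proj₁; proj₂)
open import Data.Product.Properties as ProdP using ()
open import Data.Sum using (_⊎_)
open import Data.List as List using (List; []; _∷_; _++_; filter; length; map; foldr; concatMap)
open import Data.List.Membership.Propositional using (_∈_; _∉_)
open import Data.List.Relation.Unary.All using (All)
open import Relation.Nullary using (¬_; Dec; yes; no)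
open import Relation.Nullary.Decidable using (⌊_⌋; _⊎-dec_; ¬?)
open import Relation.Binary.PropositionalEquality using (_≡_; _≢_)
open import Algebra.Bundles using (CommutativeRing)
open import Function.Bundles using (_⇔_)

record Field (c ℓ : Level) : Set (lsuc (c ⊔ ℓ)) where
  field
    commutativeRing : CommutativeRing c ℓ
  open CommutativeRing commutativeRing public
  field
    1≉0     : ¬ (1# ≈ 0#)
    inverse : ∀ x → ¬ (x ≈ 0#) → ∃[ y ] (x * y ≈ 1#)

-- Elementary cubes in ℝ^N.  An elementary cube is v + [0,1]^S where
-- v ∈ ℤ^N is the lattice base point and S ⊆ {1..N} the set of
-- coordinate directions it spans; its dimension is ∣ S ∣.

Cube : ℕ → Set
Cube N = Vec ℤ N × Subset N

_+e_ : ∀ {N} → Vec ℤ N → Fin N → Vec ℤ N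
v +e i = v [ i ]%= (λ z → z ℤ.+ ℤ.1ℤ)

data _isFacetOf_ {N : ℕ} : Cube N → Cube N → Set where
  lowerFacet : ∀ {v S} (i : Fin N) → lookup S i ≡ true →
               (v , S [ i ]≔ false) isFacetOf (v , S)
  upperFacet : ∀ {v S} (i : Fin N) → lookup S i ≡ true →
               ((v +e i) , S [ i ]≔ false) isFacetOf (v , S)

ShareFacet : ∀ {N} → Cube N → Cube N → Set
ShareFacet c d = c ≢ d × ∃[ f ] (f isFacetOf c × f isFacetOf d)

-- Cubiculated regions: a finite homogeneous n-dimensional cubical
-- complex in ℝ^N, given by its (distinct) elementary n-cubes,
-- enumerated as cube 0, …, cube (size - 1).

record Region : Set where
  field
    N n    : ℕ
    size   : ℕ
    cube   : Fin size → Cube N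
    distinct : ∀ k l → cube k ≡ cube l → k ≡ l
    dimension : ∀ k → ∣ proj₂ (cube k) ∣ ≡ n

module _ (R : Region) where
  open Region R

  -- vertices of G_R are the indices Fin size; an unordered pair of
  -- vertices {i,j} is represented by the ordered pair (i , j) with i < j.
  Pair : Set
  Pair = Fin size × Fin size

  pair : Fin size → Fin size → Pair
  pair i j = if ⌊ i Fin.≤? j ⌋ then (i , j) else (j , i)

  IsDomino : Pair → Set
  IsDomino (i , j) = i Fin.< j × ShareFacet (cube i) (cube j)

  -- sets of dominoes are represented by lists
  DominoSet : Set
  DominoSet = List Pair

  SameSet : DominoSet → DominoSet → Set
  SameSet A B = ∀ e → (e ∈ A) ⇔ (e ∈ B)

  _≟P_ : (e e′ : Pair) → Dec (e ≡ e′)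
  _≟P_ = ProdP.≡-dec Fin._≟_ Fin._≟_

  open import Data.List.Membership.DecPropositional _≟P_ using (_∈?_)

  covers? : (k : Fin size) (e : Pair) → Dec (proj₁ e ≡ k ⊎ proj₂ e ≡ k)
  covers? k (i , j) = (i Fin.≟ k) ⊎-dec (j Fin.≟ k)

  IsTiling : DominoSet → Set
  IsTiling T = All IsDomino T × (∀ k → length (filter (covers? k) T) ≡ 1)

  applyMove : DominoSet → DominoSet × DominoSet → DominoSet
  applyMove T (D₁ , D₂) = filter (λ e → ¬? (e ∈? D₁)) T ++ D₂

  -- flip moves: four n-cubes with the same direction set S forming a
  -- 2×2 square in the directions i ≠ j of S (cubes p, q, r, s with base
  -- points v, v+eᵢ, v+eⱼ, v+eᵢ+eⱼ); the two parallel dominoes {p,q},{r,s}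
  -- are replaced by the perpendicular dominoes {p,r},{q,s}.  (Swapping
  -- the roles of i and j yields the reverse move.)
  IsFlip : DominoSet × DominoSet → Set
  IsFlip (D₁ , D₂) =
    ∃[ p ] ∃[ q ] ∃[ r ] ∃[ s ] ∃[ v ] ∃[ S ] ∃[ i ] ∃[ j ]
      ( i ≢ j × lookup S i ≡ true × lookup S j ≡ true
      × cube p ≡ (v , S) × cube q ≡ (v +e i , S)
      × cube r ≡ (v +e j , S) × cube s ≡ ((v +e i) +e j , S)
      × D₁ ≡ pair p q ∷ pair r s ∷ []
      × D₂ ≡ pair p r ∷ pair q s ∷ [] )

  data FlipReach : DominoSet → DominoSet → Set where
    done : ∀ {T T′} → SameSet T′ T → FlipReach T T′
    step : ∀ {T T′} (M : DominoSet × DominoSet) → IsFlip M →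
           IsTiling (applyMove T M) → FlipReach (applyMove T M) T′ →
           FlipReach T T′

  FlipConnected : Set
  FlipConnected = ∀ T₁ T₂ → IsTiling T₁ → IsTiling T₂ → FlipReach T₁ T₂

  -- A monomial is an exponent matrix μ (μ i j = exponent of y_(i,j));
  -- a polynomial is a finite formal sum of terms c·μ, two polynomials
  -- being equal when all their coefficients agree.  The ring
  -- 𝕂[y_e : e ∈ E(G_R)] consists of those polynomials whose monomials
  -- only involve the variables y_e with e a domino.

  module Poly {c ℓ : Level} (𝕂 : Field c ℓ) where
    open Field 𝕂

    Mono : Set
    Mono = Vec (Vec ℕ size) size

    _≟M_ : (μ ν : Mono) → Dec (μ ≡ ν)
    _≟M_ = VecP.≡-dec (VecP.≡-dec ℕ._≟_)

    Polynomial : Set c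
    Polynomial = List (Carrier × Mono)

    coeff : Polynomial → Mono → Carrier
    coeff [] μ = 0#
    coeff ((a , ν) ∷ p) μ = if ⌊ ν ≟M μ ⌋ then a + coeff p μ else coeff p μ

    _≈P_ : Polynomial → Polynomial → Set ℓ
    p ≈P q = ∀ μ → coeff p μ ≈ coeff q μ

    oneM : Mono
    oneM = replicate size (replicate size 0)

    _·M_ : Mono → Mono → Mono
    μ ·M ν = zipWith (zipWith ℕ._+_) μ ν

    _+P_ : Polynomial → Polynomial → Polynomial
    p +P q = p ++ q

    -P_ : Polynomial → Polynomial
    -P p = map (λ t → (- proj₁ t , proj₂ t)) p

    _-P_ : Polynomial → Polynomial → Polynomial
    p -P q = p +P (-P q)

    _*P_ : Polynomial → Polynomial → Polynomial
    p *P q = concatMap (λ t → map (λ u → (proj₁ t * proj₁ u , proj₂ t ·M proj₂ u)) q) p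

    sumP : List Polynomial → Polynomial
    sumP = foldr _+P_ []

    monoOf : DominoSet → Mono
    monoOf [] = oneM
    monoOf ((i , j) ∷ D) = monoOf D [ i ]%= (λ row → row [ j ]%= suc)

    y^ : DominoSet → Polynomial
    y^ D = (1# , monoOf D) ∷ []

    InRing : Polynomial → Set c
    InRing p = All (λ t → ∀ i j → ¬ IsDomino (i , j) → lookup (lookup (proj₂ t) i) j ≡ 0) p

    InIdeal : (Polynomial → Set c) → Polynomial → Set (c ⊔ ℓ)
    InIdeal Gen f =
      ∃[ hs ] (All (λ hg → InRing (proj₁ hg) × Gen (proj₂ hg)) hs
              × f ≈P sumP (map (λ hg → proj₁ hg *P proj₂ hg) hs))

    _⊆I_ : (Polynomial → Set c) → (Polynomial → Set c) → Set (c ⊔ ℓ)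
    G₁ ⊆I G₂ = ∀ f → InIdeal G₁ f → InIdeal G₂ f

    FlipGen : Polynomial → Set c
    FlipGen g = ∃[ D₁ ] ∃[ D₂ ] (IsFlip (D₁ , D₂) × g ≡ y^ D₁ -P y^ D₂)

    TilingGen : Polynomial → Set c
    TilingGen g = ∃[ T₁ ] ∃[ T₂ ] (IsTiling T₁ × IsTiling T₂ × g ≡ y^ T₁ -P y^ T₂)

    TilingIdeal⊆FlipIdeal : Set (c ⊔ ℓ)
    TilingIdeal⊆FlipIdeal = TilingGen ⊆I FlipGen

-- (⇒) If T₁ reaches T₂ by flips T = K ∪ D₁ ↦ K ∪ D₂ through tilings, then
--     y^T − y^T₂ telescopes into Σ y^K·(y^D₁ − y^D₂) + 0, so every generator
--     of the tiling ideal, and hence the whole ideal, lies in the flip ideal.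
-- (⇐) Write y^T₁ − y^T₂ = Σ h·(y^D₁ − y^D₂).  Every term y^ν of a multiplier h
--     links the monomials ν·y^D₁ and ν·y^D₂; if a tiling has monomial ν·y^D₂
--     and reaches T₂, so does every tiling with monomial ν·y^D₁, since the flip
--     applies to it.  Closing {y^T₂} backwards under these links gives a finite
--     set Cl of such monomials on which the linear functional "sum of the
--     coefficients on Cl" kills every h·(y^D₁ − y^D₂); were y^T₁ ∉ Cl it would
--     send y^T₁ − y^T₂ to −1 ≠ 0.
-- The file develops: counting in lists and multiplicities, backward closure in
-- finite graphs, the combinatorics of tilings and flips, and finally monomials,
-- coefficients, ideals and the two directions of the theorem.

module Submission where

open import Defs
open import Level using (Level; 0ℓ)
open import Function using (_∘_; id)
open import Function.Bundles using (_⇔_; mk⇔; Equivalence)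
open import Data.Bool using (true; false; if_then_else_)
open import Data.Maybe using (nothing)
open import Data.Nat as Nat using (ℕ; zero; suc; _≤_; z≤n; s≤s)
import Data.Nat.Properties as ℕP
open import Data.Integer as ℤ using (ℤ)
import Data.Integer.Properties as ℤP
open import Data.Fin as Fin using (Fin)
import Data.Fin.Properties as FinP
open import Data.Fin.Subset using (Subset)
open import Data.Vec using (Vec; lookup; _[_]≔_)
import Data.Vec.Properties as VecP
open import Data.Product using (∃-syntax; _×_; _,_; proj₁; proj₂)
open import Data.Sum as Sum using (_⊎_; inj₁; inj₂)
open import Data.Empty using (⊥-elim)
open import Data.List using (List; []; _∷_; _++_; filter; length; map)
open import Data.List.Properties using (filter-++; length-++; length-++-sucʳ; filter-none)
open import Data.List.Membership.Propositional using (_∈_; _∉_; find; lose)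
open import Data.List.Membership.Propositional.Properties using (∈-filter⁺; ∈-filter⁻; ∈-∃++; ∈-++⁻; ∈-++⁺ˡ; ∈-++⁺ʳ)
open import Data.List.Relation.Unary.Any using (here; there; any?)
open import Data.List.Relation.Unary.All as All using (All; []; _∷_)
import Data.List.Relation.Unary.All.Properties as AllP
open import Data.List.Relation.Unary.Unique.Propositional using (Unique)
open import Data.List.Relation.Unary.AllPairs using ([]; _∷_)
open import Data.List.Relation.Binary.Permutation.Propositional using (_↭_; ↭-refl; ↭-sym; ↭-trans; ↭-prep; swap)
open import Data.List.Relation.Binary.Permutation.Propositional.Properties using (↭-length; filter-↭; shift)
open import Relation.Nullary using (¬_; Dec; yes; no; does)
open import Relation.Nullary.Decidable using (¬?; _×-dec_; decidable-stable)
open import Relation.Unary using (Pred; Decidable)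
open import Relation.Binary.Definitions using (DecidableEquality)
open import Relation.Binary.PropositionalEquality as Eq
  using (_≡_; _≢_; refl; sym; trans; cong; cong₂; subst; subst₂; module ≡-Reasoning)
open import Tactic.RingSolver.Core.AlmostCommutativeRing using (AlmostCommutativeRing; fromCommutativeRing)
import Algebra.Properties.Ring

module Counting {A : Set} where
  open Nat using (_+_)

  count : {P : Pred A 0ℓ} → Decidable P → List A → ℕ
  count P? xs = length (filter P? xs)

  count-++ : {P : Pred A 0ℓ} (P? : Decidable P) (xs ys : List A) →
             count P? (xs ++ ys) ≡ count P? xs + count P? ys
  count-++ P? xs ys = trans (cong length (filter-++ P? xs ys)) (length-++ (filter P? xs))

  count-↭ : {P : Pred A 0ℓ} (P? : Decidable P) {xs ys : List A} → xs ↭ ys → count P? xs ≡ count P? ys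
  count-↭ P? xs↭ys = ↭-length (filter-↭ P? xs↭ys)

  count-split : {P Q : Pred A 0ℓ} (P? : Decidable P) (Q? : Decidable Q) (xs : List A) →
                count P? xs ≡ count P? (filter Q? xs) + count P? (filter (¬? ∘ Q?) xs)
  count-split P? Q? [] = refl
  count-split P? Q? (x ∷ xs) with Q? x
  ... | yes _ with P? x
  ...   | yes _ = cong suc (count-split P? Q? xs)
  ...   | no _  = count-split P? Q? xs
  count-split P? Q? (x ∷ xs) | no _ with P? x
  ...   | yes _ = trans (cong suc (count-split P? Q? xs)) (sym (ℕP.+-suc _ _))
  ...   | no _  = count-split P? Q? xs

  count-mono : {P Q : Pred A 0ℓ} (P? : Decidable P) (Q? : Decidable Q) → (∀ x → P x → Q x) →
               (xs : List A) → count P? xs ≤ count Q? xs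
  count-mono P? Q? P⇒Q [] = z≤n
  count-mono P? Q? P⇒Q (x ∷ xs) with P? x | Q? x
  ... | yes _ | yes _ = s≤s (count-mono P? Q? P⇒Q xs)
  ... | yes p | no ¬q = ⊥-elim (¬q (P⇒Q x p))
  ... | no _  | yes _ = ℕP.m≤n⇒m≤1+n (count-mono P? Q? P⇒Q xs)
  ... | no _  | no _  = count-mono P? Q? P⇒Q xs

  count-filter-weaker : {P Q : Pred A 0ℓ} (P? : Decidable P) (Q? : Decidable Q) → (∀ x → P x → Q x) →
                        (xs : List A) → count P? (filter Q? xs) ≡ count P? xs
  count-filter-weaker P? Q? P⇒Q [] = refl
  count-filter-weaker P? Q? P⇒Q (x ∷ xs) with Q? x
  ... | yes _ with P? x
  ...   | yes _ = cong suc (count-filter-weaker P? Q? P⇒Q xs)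
  ...   | no _  = count-filter-weaker P? Q? P⇒Q xs
  count-filter-weaker P? Q? P⇒Q (x ∷ xs) | no ¬q with P? x
  ...   | yes p = ⊥-elim (¬q (P⇒Q x p))
  ...   | no _  = count-filter-weaker P? Q? P⇒Q xs

  nonempty : {y : A} {ys : List A} → y ∈ ys → 1 ≤ length ys
  nonempty (here _)  = s≤s z≤n
  nonempty (there _) = s≤s z≤n

  some-member : (ys : List A) → 1 ≤ length ys → ∃[ y ] (y ∈ ys)
  some-member (y ∷ _) _ = y , here refl

  count-positive : {P : Pred A 0ℓ} (P? : Decidable P) {x : A} {xs : List A} → x ∈ xs → P x → 1 ≤ count P? xs
  count-positive P? x∈xs px = nonempty (∈-filter⁺ P? x∈xs px)

  count-witness : {P : Pred A 0ℓ} (P? : Decidable P) (xs : List A) → 1 ≤ count P? xs → ∃[ x ] (x ∈ xs × P x)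
  count-witness P? xs 1≤count =
    let x , x∈filter = some-member (filter P? xs) 1≤count in x , ∈-filter⁻ P? x∈filter

  count-zero : {P : Pred A 0ℓ} (P? : Decidable P) (xs : List A) → (∀ x → x ∈ xs → ¬ P x) → count P? xs ≡ 0
  count-zero P? xs none = cong length (filter-none P? (All.tabulate (λ {x} → none x)))

  module Multiplicity (_≟_ : DecidableEquality A) where

    occ : A → List A → ℕ
    occ x = count (_≟ x)

    occ-∈ : {x : A} {xs : List A} → x ∈ xs → 1 ≤ occ x xs
    occ-∈ x∈xs = count-positive (_≟ _) x∈xs refl

    occ⇒∈ : (x : A) (xs : List A) → 1 ≤ occ x xs → x ∈ xs
    occ⇒∈ x xs 1≤occ with count-witness (_≟ x) xs 1≤occ
    ... | _ , x∈xs , refl = x∈xs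

    occ-∉ : (x : A) (xs : List A) → x ∉ xs → occ x xs ≡ 0
    occ-∉ x xs x∉xs = count-zero (_≟ x) xs (λ y y∈xs y≡x → x∉xs (subst (_∈ xs) y≡x y∈xs))

    occ⇒↭ : (xs ys : List A) → (∀ e → occ e xs ≡ occ e ys) → xs ↭ ys
    occ⇒↭ [] [] _ = _↭_.refl
    occ⇒↭ [] (y ∷ ys) same with subst (1 ≤_) (sym (same y)) (occ-∈ (here refl))
    ... | ()
    occ⇒↭ (x ∷ xs) ys same
      with ∈-∃++ (occ⇒∈ x ys (subst (1 ≤_) (same x) (occ-∈ (here refl))))
    ... | ys₁ , ys₂ , refl = ↭-trans (↭-prep x (occ⇒↭ xs (ys₁ ++ ys₂) sameTail)) (↭-sym (shift x ys₁ ys₂))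
      where
      sameTail : ∀ e → occ e xs ≡ occ e (ys₁ ++ ys₂)
      sameTail e = ℕP.+-cancelˡ-≡ (occ e (x ∷ [])) _ _
        (trans (sym (count-++ (_≟ e) (x ∷ []) xs))
        (trans (same e)
        (trans (count-↭ (_≟ e) (shift x ys₁ ys₂)) (count-++ (_≟ e) (x ∷ []) (ys₁ ++ ys₂)))))

    count-by-occ : {P : Pred A 0ℓ} (P? : Decidable P) (xs ys : List A) →
                   (∀ e → occ e xs ≡ occ e ys) → count P? xs ≡ count P? ys
    count-by-occ P? xs ys same = count-↭ P? (occ⇒↭ xs ys same)

    occ-two : ∀ {x y} → x ≢ y → ∀ {e} → e ∈ x ∷ y ∷ [] → occ e (x ∷ y ∷ []) ≡ 1
    occ-two {x} {y} x≢y (here refl) with x ≟ x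
    ... | no x≢x = ⊥-elim (x≢x refl)
    ... | yes _ with y ≟ x
    ...   | yes y≡x = ⊥-elim (x≢y (sym y≡x))
    ...   | no _    = refl
    occ-two {x} {y} x≢y (there (here refl)) with x ≟ y
    ... | yes x≡y = ⊥-elim (x≢y x≡y)
    ... | no _ with y ≟ y
    ...   | yes _   = refl
    ...   | no y≢y  = ⊥-elim (y≢y refl)

module BackwardClosure {V Edge : Set} (source target : Edge → V) where

  BackClosed : List V → List Edge → Set
  BackClosed Cl E = ∀ {e} → e ∈ E → target e ∈ Cl → source e ∈ Cl

  module _ (_≟_ : DecidableEquality V) (Good : Pred V 0ℓ)
           (good-back : ∀ e → Good (target e) → Good (source e)) where
    open import Data.List.Membership.DecPropositional _≟_ using (_∈?_)

    find-entry : ∀ Cl E → (∃[ e ] (e ∈ E × target e ∈ Cl × source e ∉ Cl)) ⊎ BackClosed Cl E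
    find-entry Cl E with any? (λ e → (target e ∈? Cl) ×-dec (¬? (source e ∈? Cl))) E
    ... | yes entry = inj₁ (let e , e∈E , t∈Cl , s∉Cl = find entry in e , e∈E , t∈Cl , s∉Cl)
    ... | no none   = inj₂ λ {e} e∈E t∈Cl →
      decidable-stable (source e ∈? Cl) (λ s∉Cl → none (lose e∈E (t∈Cl , s∉Cl)))

    record Closure (x₀ : V) (E₀ : List Edge) : Set where
      field
        Cl     : List V
        unique : Unique Cl
        good   : All Good Cl
        start  : x₀ ∈ Cl
        closed : BackClosed Cl E₀

    Invariant : List Edge → List Edge → List V → Set
    Invariant E₀ pending Cl = ∀ {e} → e ∈ E₀ → e ∈ pending ⊎ source e ∈ Cl

    -- Add sources of entering edges one at a time; each addition removes an edge
    -- from the pending list, whose length n bounds the remaining work.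
    grow : ∀ {x₀} E₀ n (pending : List Edge) (Cl : List V) → length pending ≡ n →
           Unique Cl → All Good Cl → x₀ ∈ Cl → Invariant E₀ pending Cl → Closure x₀ E₀
    add : ∀ {x₀} E₀ n {pending : List Edge} {Cl : List V} {e} → length pending ≡ n →
          e ∈ pending → target e ∈ Cl → source e ∉ Cl →
          Unique Cl → All Good Cl → x₀ ∈ Cl → Invariant E₀ pending Cl → Closure x₀ E₀

    grow E₀ n pending Cl len unique good start invariant with find-entry Cl pending
    ... | inj₁ (e , e∈pending , t∈Cl , s∉Cl) = add E₀ n len e∈pending t∈Cl s∉Cl unique good start invariant
    ... | inj₂ closed = record { Cl = Cl ; unique = unique ; good = good ; start = start ; closed = closed₀ }
      where
      closed₀ : BackClosed Cl E₀
      closed₀ e∈E₀ t∈Cl = Sum.[ (λ e∈pending → closed e∈pending t∈Cl) , id ] (invariant e∈E₀)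

    add E₀ zero len e∈pending _ _ _ _ _ _ with subst (1 ≤_) len (Counting.nonempty e∈pending)
    ... | ()
    add E₀ (suc n) {Cl = Cl} {e} len e∈pending t∈Cl s∉Cl unique good start invariant with ∈-∃++ e∈pending
    ... | P₁ , P₂ , refl =
      grow E₀ n (P₁ ++ P₂) (source e ∷ Cl) (ℕP.suc-injective (trans (sym (length-++-sucʳ P₁ e P₂)) len))
           (All.tabulate (λ s∈Cl s≡ → s∉Cl (subst (_∈ Cl) (sym s≡) s∈Cl)) ∷ unique)
           (good-back e (All.lookup good t∈Cl) ∷ good) (there start) invariant′
      where
      invariant′ : Invariant E₀ (P₁ ++ P₂) (source e ∷ Cl)
      invariant′ e′∈E₀ with invariant e′∈E₀
      ... | inj₂ s∈Cl = inj₂ (there s∈Cl)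
      ... | inj₁ e′∈pending with ∈-++⁻ P₁ e′∈pending
      ...   | inj₁ e′∈P₁ = inj₁ (∈-++⁺ˡ e′∈P₁)
      ...   | inj₂ (here refl) = inj₂ (here refl)
      ...   | inj₂ (there e′∈P₂) = inj₁ (∈-++⁺ʳ P₁ e′∈P₂)

    closure : ∀ {x₀} E₀ → Good x₀ → Closure x₀ E₀
    closure E₀ good₀ = grow E₀ (length E₀) E₀ (_ ∷ []) refl ([] ∷ []) (good₀ ∷ []) (here refl) inj₁

module Dominoes (R : Region) where
  open Region R
  open Nat using (_+_)
  open Counting

  _≟D_ : DecidableEquality (Pair R)
  _≟D_ = _≟P_ R

  open Multiplicity _≟D_ public
  open import Data.List.Membership.DecPropositional _≟D_ using (_∈?_)

  cover : Fin size → DominoSet R → ℕ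
  cover k = count (covers? R k)

  -- In a tiling every domino occurs at most once, since each occurrence of
  -- e = (i , j) covers the cube i, which is covered exactly once.
  tiling-occ≤1 : ∀ {T} → IsTiling R T → ∀ e → occ e T ≤ 1
  tiling-occ≤1 {T} (_ , covered) e = subst (occ e T ≤_) (covered (proj₁ e))
    (count-mono (_≟D e) (covers? R (proj₁ e)) (λ x x≡e → inj₁ (cong proj₁ x≡e)) T)

  tiling-occ-∈ : ∀ {T} → IsTiling R T → ∀ {e} → e ∈ T → occ e T ≡ 1
  tiling-occ-∈ tiling {e} e∈T = ℕP.≤-antisym (tiling-occ≤1 tiling e) (occ-∈ e∈T)

  sameSet⇒occ : ∀ {T T′} → IsTiling R T → IsTiling R T′ → SameSet R T′ T → ∀ e → occ e T ≡ occ e T′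
  sameSet⇒occ {T} {T′} tiling tiling′ same e with e ∈? T
  ... | yes e∈T = trans (tiling-occ-∈ tiling e∈T) (sym (tiling-occ-∈ tiling′ (Equivalence.from (same e) e∈T)))
  ... | no e∉T  = trans (occ-∉ e T e∉T) (sym (occ-∉ e T′ (e∉T ∘ Equivalence.to (same e))))

  occ⇒sameSet : ∀ T T′ → (∀ e → occ e T ≡ occ e T′) → SameSet R T′ T
  occ⇒sameSet T T′ same e =
    mk⇔ (λ e∈T′ → occ⇒∈ e T (subst (1 ≤_) (sym (same e)) (occ-∈ e∈T′)))
        (λ e∈T  → occ⇒∈ e T′ (subst (1 ≤_) (same e) (occ-∈ e∈T)))

  dominoes-occ : ∀ {L} e → All (IsDomino R) L → ¬ IsDomino R e → occ e L ≡ 0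
  dominoes-occ {L} e dominoes notDomino =
    occ-∉ e L (λ e∈L → notDomino (All.lookup dominoes e∈L))

  Covers : Pair R → Fin size → Set
  Covers e k = proj₁ e ≡ k ⊎ proj₂ e ≡ k

  pair-covers⁻ : ∀ {k} a b → Covers (pair R a b) k → a ≡ k ⊎ b ≡ k
  pair-covers⁻ a b c with a Fin.≤? b
  ... | yes _ = c
  ... | no _  = Sum.swap c

  pair-covers⁺ : ∀ {k} a b → a ≡ k ⊎ b ≡ k → Covers (pair R a b) k
  pair-covers⁺ a b c with a Fin.≤? b
  ... | yes _ = c
  ... | no _  = Sum.swap c

  cover-pair : ∀ k a b → a ≢ b → cover k (pair R a b ∷ []) ≡ count (Fin._≟ k) (a ∷ b ∷ [])
  cover-pair k a b a≢b = trans (byCases a b a≢b) (sym (count-++ (Fin._≟ k) (a ∷ []) (b ∷ [])))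
    where
    byCases : ∀ a b → a ≢ b →
              cover k (pair R a b ∷ []) ≡ count (Fin._≟ k) (a ∷ []) + count (Fin._≟ k) (b ∷ [])
    byCases a b a≢b with a Fin.≤? b
    ... | yes _ with a Fin.≟ k | b Fin.≟ k
    ...   | yes refl | yes refl = ⊥-elim (a≢b refl)
    ...   | yes _    | no _     = refl
    ...   | no _     | yes _    = refl
    ...   | no _     | no _     = refl
    byCases a b a≢b | no _ with a Fin.≟ k | b Fin.≟ k
    ...   | yes refl | yes refl = ⊥-elim (a≢b refl)
    ...   | yes _    | no _     = refl
    ...   | no _     | yes _    = refl
    ...   | no _     | no _     = refl

  pair-≢ : ∀ a b c d → a ≢ c → a ≢ d → pair R a b ≢ pair R c d
  pair-≢ a b c d a≢c a≢d eq
    with pair-covers⁻ c d (subst (λ e → Covers e a) eq (pair-covers⁺ a b (inj₁ refl)))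
  ... | inj₁ c≡a = a≢c (sym c≡a)
  ... | inj₂ d≡a = a≢d (sym d≡a)

  +e-self : (v : Vec ℤ N) (i : Fin N) → lookup (v +e i) i ≡ lookup v i ℤ.+ ℤ.1ℤ
  +e-self v i = VecP.lookup∘updateAt i v

  +e-other : (v : Vec ℤ N) (i t : Fin N) → t ≢ i → lookup (v +e i) t ≡ lookup v t
  +e-other v i t t≢i = VecP.lookup∘updateAt′ t i t≢i v

  +e-comm : (v : Vec ℤ N) (i j : Fin N) → i ≢ j → (v +e i) +e j ≡ (v +e j) +e i
  +e-comm v i j i≢j = VecP.updateAt-commutes j i (i≢j ∘ sym) v

  cubes-differ : ∀ {a b} {u w : Vec ℤ N} {S S′ : Subset N} t →
                 cube a ≡ (u , S) → cube b ≡ (w , S′) → lookup w t ≡ lookup u t ℤ.+ ℤ.1ℤ → a ≢ b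
  cubes-differ {u = u} t ca cb w≡u+1 refl =
    ℤP.i≢suc[i] (trans (cong (λ c → lookup (proj₁ c) t) (trans (sym ca) cb))
                       (trans w≡u+1 (ℤP.+-comm (lookup u t) ℤ.1ℤ)))

  -- v + [0,1]^S and v + e_t + [0,1]^S (t ∈ S) share the facet v + e_t + [0,1]^(S ∖ t)
  neighbours-share-facet : ∀ {a b} {v : Vec ℤ N} {S : Subset N} t →
                           cube a ≡ (v , S) → cube b ≡ (v +e t , S) → lookup S t ≡ true →
                           ShareFacet (cube a) (cube b)
  neighbours-share-facet {a} {b} {v} {S} t ca cb t∈S =
    subst₂ ShareFacet (sym ca) (sym cb)
      ( (λ eq → cubes-differ t ca cb (+e-self v t) (distinct a b (trans ca (trans eq (sym cb)))))
      , (v +e t , S [ t ]≔ false) , upperFacet t t∈S , lowerFacet t t∈S )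

  shareFacet-sym : ∀ {c d : Cube N} → ShareFacet c d → ShareFacet d c
  shareFacet-sym (c≢d , f , f⊂c , f⊂d) = c≢d ∘ sym , f , f⊂d , f⊂c

  neighbour-domino : ∀ {a b} {v : Vec ℤ N} {S : Subset N} t →
                     cube a ≡ (v , S) → cube b ≡ (v +e t , S) → lookup S t ≡ true → IsDomino R (pair R a b)
  neighbour-domino {a} {b} {v} t ca cb t∈S with a Fin.≤? b
  ... | yes a≤b = FinP.≤∧≢⇒< a≤b (cubes-differ t ca cb (+e-self v t)) , neighbours-share-facet t ca cb t∈S
  ... | no a≰b  = ℕP.≰⇒> a≰b , shareFacet-sym (neighbours-share-facet t ca cb t∈S)

  record FlipSquare (D₁ D₂ : DominoSet R) : Set where
    field
      p q r s     : Fin size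
      D₁≡         : D₁ ≡ pair R p q ∷ pair R r s ∷ []
      D₂≡         : D₂ ≡ pair R p r ∷ pair R q s ∷ []
      p≢q         : p ≢ q
      p≢r         : p ≢ r
      p≢s         : p ≢ s
      q≢s         : q ≢ s
      r≢s         : r ≢ s
      D₂-dominoes : All (IsDomino R) D₂

  -- The four cubes sit at v, v + eᵢ, v + eⱼ, v + eᵢ + eⱼ, so any two of them
  -- differ in the i- or the j-coordinate.
  flipSquare : ∀ {D₁ D₂} → IsFlip R (D₁ , D₂) → FlipSquare D₁ D₂
  flipSquare (p , q , r , s , v , S , i , j , i≢j , i∈S , j∈S , cp , cq , cr , cs , D₁≡ , D₂≡) = record
    { p = p ; q = q ; r = r ; s = s ; D₁≡ = D₁≡ ; D₂≡ = D₂≡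
    ; p≢q = cubes-differ i cp cq (+e-self v i)
    ; p≢r = cubes-differ j cp cr (+e-self v j)
    ; p≢s = cubes-differ i cp cs (trans (+e-other (v +e i) j i i≢j) (+e-self v i))
    ; q≢s = cubes-differ j cq cs (+e-self (v +e i) j)
    ; r≢s = cubes-differ i cr cs (trans (+e-other (v +e i) j i i≢j)
                                 (trans (+e-self v i) (cong (ℤ._+ ℤ.1ℤ) (sym (+e-other v j i i≢j)))))
    ; D₂-dominoes = subst (All (IsDomino R)) (sym D₂≡)
        (neighbour-domino j cp cr j∈S ∷ neighbour-domino j cq cs j∈S ∷ [])
    }

  -- the reverse of a flip is a flip (exchange the roles of i and j)
  flip-reverse : ∀ {D₁ D₂} → IsFlip R (D₁ , D₂) → IsFlip R (D₂ , D₁)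
  flip-reverse (p , q , r , s , v , S , i , j , i≢j , i∈S , j∈S , cp , cq , cr , cs , D₁≡ , D₂≡) =
    p , r , q , s , v , S , j , i , i≢j ∘ sym , j∈S , i∈S , cp , cr , cq ,
    trans cs (cong (_, S) (+e-comm v i j i≢j)) , D₂≡ , D₁≡

  -- a flip removes and adds dominoes covering the same four cubes
  flip-preserves-cover : ∀ {D₁ D₂} → FlipSquare D₁ D₂ → ∀ k → cover k D₁ ≡ cover k D₂
  flip-preserves-cover F k rewrite FlipSquare.D₁≡ F | FlipSquare.D₂≡ F = begin
    cover k (pair R p q ∷ pair R r s ∷ [])
      ≡⟨ count-++ (covers? R k) (pair R p q ∷ []) (pair R r s ∷ []) ⟩
    cover k (pair R p q ∷ []) + cover k (pair R r s ∷ [])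
      ≡⟨ cong₂ _+_ (cover-pair k p q p≢q) (cover-pair k r s r≢s) ⟩
    count (Fin._≟ k) (p ∷ q ∷ []) + count (Fin._≟ k) (r ∷ s ∷ [])
      ≡⟨ sym (count-++ (Fin._≟ k) (p ∷ q ∷ []) (r ∷ s ∷ [])) ⟩
    count (Fin._≟ k) (p ∷ q ∷ r ∷ s ∷ [])
      ≡⟨ count-↭ (Fin._≟ k) (↭-prep p (swap q r ↭-refl)) ⟩
    count (Fin._≟ k) (p ∷ r ∷ q ∷ s ∷ [])
      ≡⟨ count-++ (Fin._≟ k) (p ∷ r ∷ []) (q ∷ s ∷ []) ⟩
    count (Fin._≟ k) (p ∷ r ∷ []) + count (Fin._≟ k) (q ∷ s ∷ [])
      ≡⟨ sym (cong₂ _+_ (cover-pair k p r p≢r) (cover-pair k q s q≢s)) ⟩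
    cover k (pair R p r ∷ []) + cover k (pair R q s ∷ [])
      ≡⟨ sym (count-++ (covers? R k) (pair R p r ∷ []) (pair R q s ∷ [])) ⟩
    cover k (pair R p r ∷ pair R q s ∷ []) ∎
    where
    open FlipSquare F
    open ≡-Reasoning

  removed-occ : ∀ {D₁ D₂} → FlipSquare D₁ D₂ → ∀ {e} → e ∈ D₁ → occ e D₁ ≡ 1
  removed-occ F {e} e∈D₁ rewrite FlipSquare.D₁≡ F = occ-two (pair-≢ p q r s p≢r p≢s) e∈D₁
    where
    open FlipSquare F

  module _ (D₁ : DominoSet R) (T : DominoSet R) where
    removed kept : DominoSet R
    removed = filter (_∈? D₁) T
    kept    = filter (λ e → ¬? (e ∈? D₁)) T

  module ApplyFlip {D₁ D₂ : DominoSet R} (F : FlipSquare D₁ D₂) {T : DominoSet R} (tiling : IsTiling R T) where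
    open ≡-Reasoning

    T′ : DominoSet R
    T′ = applyMove R T (D₁ , D₂)

    cover-before : ∀ k → cover k T ≡ cover k (removed D₁ T) + cover k (kept D₁ T)
    cover-before k = count-split (covers? R k) (_∈? D₁) T

    cover-after : ∀ k → cover k T′ ≡ cover k (kept D₁ T) + cover k D₂
    cover-after k = count-++ (covers? R k) (kept D₁ T) D₂

    removed-occ-≡ : All (_∈ T) D₁ → ∀ e → occ e (removed D₁ T) ≡ occ e D₁
    removed-occ-≡ D₁⊆T e with e ∈? D₁
    ... | yes e∈D₁ = begin
      occ e (removed D₁ T) ≡⟨ count-filter-weaker (_≟D e) (_∈? D₁) (λ x x≡e → subst (_∈ D₁) (sym x≡e) e∈D₁) T ⟩
      occ e T              ≡⟨ tiling-occ-∈ tiling (All.lookup D₁⊆T e∈D₁) ⟩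
      1                    ≡⟨ sym (removed-occ F e∈D₁) ⟩
      occ e D₁             ∎
    ... | no e∉D₁ = begin
      occ e (removed D₁ T) ≡⟨ occ-∉ e (removed D₁ T) (e∉D₁ ∘ proj₂ ∘ ∈-filter⁻ (_∈? D₁) {xs = T}) ⟩
      0                    ≡⟨ sym (occ-∉ e D₁ e∉D₁) ⟩
      occ e D₁             ∎

    flip-step : All (_∈ T) D₁ → IsTiling R T′ × (∀ e → occ e T ≡ occ e (kept D₁ T) + occ e D₁)
    flip-step D₁⊆T = (dominoes , covered) , occ-T
      where
      dominoes : All (IsDomino R) T′
      dominoes = AllP.++⁺ (AllP.filter⁺ _ (proj₁ tiling)) (FlipSquare.D₂-dominoes F)
      covered : ∀ k → cover k T′ ≡ 1
      covered k = begin
        cover k T′                                   ≡⟨ cover-after k ⟩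
        cover k (kept D₁ T) + cover k D₂             ≡⟨ cong (cover k (kept D₁ T) +_) (sym (flip-preserves-cover F k)) ⟩
        cover k (kept D₁ T) + cover k D₁             ≡⟨ cong (cover k (kept D₁ T) +_)
                                                          (sym (count-by-occ (covers? R k) (removed D₁ T) D₁ (removed-occ-≡ D₁⊆T))) ⟩
        cover k (kept D₁ T) + cover k (removed D₁ T) ≡⟨ ℕP.+-comm (cover k (kept D₁ T)) _ ⟩
        cover k (removed D₁ T) + cover k (kept D₁ T) ≡⟨ sym (cover-before k) ⟩
        cover k T                                    ≡⟨ proj₂ tiling k ⟩
        1                                            ∎
      occ-T : ∀ e → occ e T ≡ occ e (kept D₁ T) + occ e D₁
      occ-T e = begin
        occ e T                                  ≡⟨ count-split (_≟D e) (_∈? D₁) T ⟩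
        occ e (removed D₁ T) + occ e (kept D₁ T) ≡⟨ cong (_+ occ e (kept D₁ T)) (removed-occ-≡ D₁⊆T e) ⟩
        occ e D₁ + occ e (kept D₁ T)             ≡⟨ ℕP.+-comm (occ e D₁) _ ⟩
        occ e (kept D₁ T) + occ e D₁             ∎

    removed-cover : IsTiling R T′ → ∀ k → cover k (removed D₁ T) ≡ cover k D₁
    removed-cover tiling′ k = trans (ℕP.+-cancelʳ-≡ (cover k (kept D₁ T)) _ _ (begin
      cover k (removed D₁ T) + cover k (kept D₁ T) ≡⟨ sym (cover-before k) ⟩
      cover k T                                    ≡⟨ trans (proj₂ tiling k) (sym (proj₂ tiling′ k)) ⟩
      cover k T′                                   ≡⟨ cover-after k ⟩
      cover k (kept D₁ T) + cover k D₂             ≡⟨ ℕP.+-comm (cover k (kept D₁ T)) _ ⟩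
      cover k D₂ + cover k (kept D₁ T)             ∎)) (sym (flip-preserves-cover F k))

    sole-cover-∈ : IsTiling R T′ → ∀ k {x} → x ∈ D₁ → Covers x k →
                   (∀ {d} → d ∈ D₁ → Covers d k → d ≡ x) → x ∈ T
    sole-cover-∈ tiling′ k x∈D₁ x-covers sole
      with count-witness (covers? R k) (removed D₁ T)
             (subst (1 ≤_) (sym (removed-cover tiling′ k)) (count-positive (covers? R k) x∈D₁ x-covers))
    ... | d , d∈removed , d-covers with ∈-filter⁻ (_∈? D₁) d∈removed
    ...   | d∈T , d∈D₁ = subst (_∈ T) (sole d∈D₁ d-covers) d∈T

    -- A flip can only turn a tiling into a tiling if it removes dominoes of T:
    -- pq is the only removed domino covering p, and rs the only one covering s.
    flip-needs-D₁ : IsTiling R T′ → All (_∈ T) D₁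
    flip-needs-D₁ tiling′ = subst (All (_∈ T)) (sym D₁≡)
      (sole-cover-∈ tiling′ p (toD₁ (here refl)) (pair-covers⁺ p q (inj₁ refl)) sole-p ∷
       sole-cover-∈ tiling′ s (toD₁ (there (here refl))) (pair-covers⁺ r s (inj₂ refl)) sole-s ∷ [])
      where
      open FlipSquare F
      toD₁ : ∀ {d} → d ∈ pair R p q ∷ pair R r s ∷ [] → d ∈ D₁
      toD₁ = subst (_ ∈_) (sym D₁≡)
      sole-p : ∀ {d} → d ∈ D₁ → Covers d p → d ≡ pair R p q
      sole-p d∈D₁ d-covers with subst (_ ∈_) D₁≡ d∈D₁
      ... | here d≡pq = d≡pq
      ... | there (here refl) = ⊥-elim (Sum.[ p≢r ∘ sym , p≢s ∘ sym ] (pair-covers⁻ r s d-covers))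
      sole-s : ∀ {d} → d ∈ D₁ → Covers d s → d ≡ pair R r s
      sole-s d∈D₁ d-covers with subst (_ ∈_) D₁≡ d∈D₁
      ... | there (here d≡rs) = d≡rs
      ... | here refl = ⊥-elim (Sum.[ p≢s , q≢s ] (pair-covers⁻ p q d-covers))

vec-ext : ∀ {A : Set} {n} {xs ys : Vec A n} → (∀ i → lookup xs i ≡ lookup ys i) → xs ≡ ys
vec-ext {xs = xs} {ys} same =
  Eq.trans (Eq.sym (VecP.tabulate∘lookup xs)) (Eq.trans (VecP.tabulate-cong same) (VecP.tabulate∘lookup ys))

module Polynomials (R : Region) {c ℓ : Level} (𝕂 : Field c ℓ) where
  open Dominoes R
  open Poly R 𝕂
  open Field 𝕂 using (Carrier; _≈_; _+_; _*_; -_; 0#; 1#; setoid; commutativeRing; 1≉0)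
  module F = Field 𝕂
  module RingProperties = Algebra.Properties.Ring F.ring

  exponent : Mono → Pair R → ℕ
  exponent μ (i , j) = lookup (lookup μ i) j

  mono-ext : ∀ {μ ν : Mono} → (∀ e → exponent μ e ≡ exponent ν e) → μ ≡ ν
  mono-ext same = vec-ext (λ i → vec-ext (λ j → same (i , j)))

  exponent-one : ∀ e → exponent oneM e ≡ 0
  exponent-one (i , j) = Eq.trans (cong (λ row → lookup row j) (VecP.lookup-replicate i _)) (VecP.lookup-replicate j 0)

  exponent-· : ∀ μ ν e → exponent (μ ·M ν) e ≡ exponent μ e Nat.+ exponent ν e
  exponent-· μ ν (i , j) = Eq.trans (cong (λ row → lookup row j) (VecP.lookup-zipWith _ i μ ν))
                                    (VecP.lookup-zipWith _ j (lookup μ i) (lookup ν i))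

  exponent-monoOf : ∀ D e → exponent (monoOf D) e ≡ occ e D
  exponent-monoOf [] e = exponent-one e
  exponent-monoOf ((i , j) ∷ D) (k , l) with (i , j) ≟D (k , l)
  ... | yes refl = Eq.trans (cong (λ row → lookup row j) (VecP.lookup∘updateAt i (monoOf D)))
                   (Eq.trans (VecP.lookup∘updateAt j (lookup (monoOf D) i)) (cong suc (exponent-monoOf D (i , j))))
  ... | no ij≢kl with i Fin.≟ k
  ...   | no i≢k = Eq.trans (cong (λ row → lookup row l) (VecP.lookup∘updateAt′ k i (i≢k ∘ Eq.sym) (monoOf D)))
                   (exponent-monoOf D (k , l))
  ...   | yes refl = Eq.trans (cong (λ row → lookup row l) (VecP.lookup∘updateAt i (monoOf D)))
                     (Eq.trans (VecP.lookup∘updateAt′ l j (λ l≡j → ij≢kl (cong (i ,_) (Eq.sym l≡j))) (lookup (monoOf D) i))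
                     (exponent-monoOf D (i , l)))

  ·M-assoc : ∀ μ ν ρ → (μ ·M ν) ·M ρ ≡ μ ·M (ν ·M ρ)
  ·M-assoc μ ν ρ = mono-ext λ e →
    Eq.trans (exponent-· (μ ·M ν) ρ e) (Eq.trans (cong (Nat._+ exponent ρ e) (exponent-· μ ν e))
    (Eq.trans (ℕP.+-assoc (exponent μ e) _ _)
    (Eq.trans (cong (exponent μ e Nat.+_) (Eq.sym (exponent-· ν ρ e))) (Eq.sym (exponent-· μ (ν ·M ρ) e)))))

  one-·M : ∀ μ → oneM ·M μ ≡ μ
  one-·M μ = mono-ext λ e → Eq.trans (exponent-· oneM μ e) (cong (Nat._+ exponent μ e) (exponent-one e))

  monoOf-split : ∀ T A B → (∀ e → occ e T ≡ occ e A Nat.+ occ e B) → monoOf T ≡ monoOf A ·M monoOf B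
  monoOf-split T A B occ-T = mono-ext λ e →
    Eq.trans (exponent-monoOf T e) (Eq.trans (occ-T e)
    (Eq.trans (cong₂ Nat._+_ (Eq.sym (exponent-monoOf A e)) (Eq.sym (exponent-monoOf B e)))
              (Eq.sym (exponent-· (monoOf A) (monoOf B) e))))

  monoOf-++ : ∀ A B → monoOf (A ++ B) ≡ monoOf A ·M monoOf B
  monoOf-++ A B = monoOf-split (A ++ B) A B (λ e → Counting.count-++ (_≟D e) A B)

  monoOf-split⁻ : ∀ T ν D → monoOf T ≡ ν ·M monoOf D → ∀ e → occ e T ≡ exponent ν e Nat.+ occ e D
  monoOf-split⁻ T ν D y^T≡ e =
    Eq.trans (Eq.sym (exponent-monoOf T e)) (Eq.trans (cong (λ μ → exponent μ e) y^T≡)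
    (Eq.trans (exponent-· ν (monoOf D) e) (cong (exponent ν e Nat.+_) (exponent-monoOf D e))))

  monoOf-≡ : ∀ A B → (∀ e → occ e A ≡ occ e B) → monoOf A ≡ monoOf B
  monoOf-≡ A B same = mono-ext λ e →
    Eq.trans (exponent-monoOf A e) (Eq.trans (same e) (Eq.sym (exponent-monoOf B e)))

  monoOf-≡⁻ : ∀ A B → monoOf A ≡ monoOf B → ∀ e → occ e A ≡ occ e B
  monoOf-≡⁻ A B y^A≡y^B e =
    Eq.trans (Eq.sym (exponent-monoOf A e)) (Eq.trans (cong (λ μ → exponent μ e) y^A≡y^B) (exponent-monoOf B e))

  module Identities where
    open import Relation.Binary.Reasoning.Setoid setoid
    private
      ACR : AlmostCommutativeRing c ℓ
      ACR = fromCommutativeRing commutativeRing (λ _ → nothing)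
      module Solved where
        open AlmostCommutativeRing ACR using () renaming (_+_ to _⊕_; -_ to ⊝_; _≈_ to _≋_)
        open import Tactic.RingSolver using (solve-∀)
        regroup-difference : ∀ a b x y → (a ⊕ ((⊝ b) ⊕ (x ⊕ (⊝ y)))) ≋ ((a ⊕ x) ⊕ (⊝ (b ⊕ y)))
        regroup-difference = solve-∀ ACR
        interchange : ∀ a b x y → ((a ⊕ b) ⊕ (x ⊕ y)) ≋ ((a ⊕ x) ⊕ (b ⊕ y))
        interchange = solve-∀ ACR

    regroup-difference : ∀ a b x y → a + (- b + (x + - y)) ≈ (a + x) + - (b + y)
    regroup-difference = Solved.regroup-difference

    interchange : ∀ a b x y → (a + b) + (x + y) ≈ (a + x) + (b + y)
    interchange = Solved.interchange

    telescope-difference : ∀ x y z → x + - z ≈ (x + - y) + (y + - z)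
    telescope-difference x y z = F.sym (begin
      (x + - y) + (y + - z)  ≈⟨ F.+-assoc x (- y) (y + - z) ⟩
      x + (- y + (y + - z))  ≈⟨ F.+-cong F.refl (F.sym (F.+-assoc (- y) y (- z))) ⟩
      x + ((- y + y) + - z)  ≈⟨ F.+-cong F.refl (F.+-cong (F.-‿inverseˡ y) F.refl) ⟩
      x + (0# + - z)         ≈⟨ F.+-cong F.refl (F.+-identityˡ (- z)) ⟩
      x + - z                ∎)

    cancel-pair : ∀ x z → x + (- x + z) ≈ z
    cancel-pair x z = begin
      x + (- x + z)  ≈⟨ F.sym (F.+-assoc x (- x) z) ⟩
      (x + - x) + z  ≈⟨ F.+-cong (F.-‿inverseʳ x) F.refl ⟩
      0# + z         ≈⟨ F.+-identityˡ z ⟩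
      z              ∎

  open Identities
  open import Relation.Binary.Reasoning.Setoid setoid

  term : Mono → Carrier → Mono → Carrier
  term ν a μ = if does (ν ≟M μ) then a else 0#

  term-cong : ∀ ν {a b} μ → a ≈ b → term ν a μ ≈ term ν b μ
  term-cong ν μ a≈b with ν ≟M μ
  ... | yes _ = a≈b
  ... | no _  = F.refl

  term-neg : ∀ ν a μ → term ν (- a) μ ≈ - term ν a μ
  term-neg ν a μ with ν ≟M μ
  ... | yes _ = F.refl
  ... | no _  = F.sym RingProperties.-0#≈0#

  coeff-∷ : ∀ a ν p μ → coeff ((a , ν) ∷ p) μ ≈ term ν a μ + coeff p μ
  coeff-∷ a ν p μ with ν ≟M μ
  ... | yes _ = F.refl
  ... | no _  = F.sym (F.+-identityˡ _)

  coeff-∷-cong : ∀ {a b ν ν′} p q μ → a ≈ b → ν ≡ ν′ → coeff p μ ≈ coeff q μ →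
                 coeff ((a , ν) ∷ p) μ ≈ coeff ((b , ν′) ∷ q) μ
  coeff-∷-cong {a} {b} {ν} p q μ a≈b refl p≈q = begin
    coeff ((a , ν) ∷ p) μ  ≈⟨ coeff-∷ a ν p μ ⟩
    term ν a μ + coeff p μ ≈⟨ F.+-cong (term-cong ν μ a≈b) p≈q ⟩
    term ν b μ + coeff q μ ≈⟨ coeff-∷ b ν q μ ⟨
    coeff ((b , ν) ∷ q) μ  ∎

  coeff-++ : ∀ p q μ → coeff (p ++ q) μ ≈ coeff p μ + coeff q μ
  coeff-++ [] q μ = F.sym (F.+-identityˡ _)
  coeff-++ ((a , ν) ∷ p) q μ = begin
    coeff ((a , ν) ∷ (p ++ q)) μ       ≈⟨ coeff-∷ a ν (p ++ q) μ ⟩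
    term ν a μ + coeff (p ++ q) μ      ≈⟨ F.+-cong F.refl (coeff-++ p q μ) ⟩
    term ν a μ + (coeff p μ + coeff q μ) ≈⟨ F.+-assoc _ _ _ ⟨
    (term ν a μ + coeff p μ) + coeff q μ ≈⟨ F.+-cong (coeff-∷ a ν p μ) F.refl ⟨
    coeff ((a , ν) ∷ p) μ + coeff q μ  ∎

  _·y^_ : Polynomial → Mono → Polynomial
  h ·y^ u = h *P ((1# , u) ∷ [])

  binomial : Mono → Mono → Polynomial
  binomial u w = (1# , u) ∷ (- 1# , w) ∷ []

  coeff-binomial : ∀ h u w μ → coeff (h *P binomial u w) μ ≈ coeff (h ·y^ u) μ + - coeff (h ·y^ w) μ
  coeff-binomial [] u w μ = F.sym (F.-‿inverseʳ 0#)
  coeff-binomial ((a , ν) ∷ h) u w μ = begin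
    coeff (((a , ν) ∷ h) *P binomial u w) μ
      ≈⟨ F.trans (coeff-∷ (a * 1#) (ν ·M u) ((a * - 1# , ν ·M w) ∷ (h *P binomial u w)) μ) (F.+-cong F.refl (coeff-∷ (a * - 1#) (ν ·M w) (h *P binomial u w) μ)) ⟩
    term (ν ·M u) (a * 1#) μ + (term (ν ·M w) (a * - 1#) μ + coeff (h *P binomial u w) μ)
      ≈⟨ F.+-cong F.refl (F.+-cong negated (coeff-binomial h u w μ)) ⟩
    term (ν ·M u) (a * 1#) μ + (- term (ν ·M w) (a * 1#) μ + (coeff (h ·y^ u) μ + - coeff (h ·y^ w) μ))
      ≈⟨ regroup-difference _ _ _ _ ⟩
    (term (ν ·M u) (a * 1#) μ + coeff (h ·y^ u) μ) + - (term (ν ·M w) (a * 1#) μ + coeff (h ·y^ w) μ)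
      ≈⟨ F.+-cong (coeff-∷ (a * 1#) (ν ·M u) (h ·y^ u) μ) (F.-‿cong (coeff-∷ (a * 1#) (ν ·M w) (h ·y^ w) μ)) ⟨
    coeff (((a , ν) ∷ h) ·y^ u) μ + - coeff (((a , ν) ∷ h) ·y^ w) μ ∎
    where
    negated : term (ν ·M w) (a * - 1#) μ ≈ - term (ν ·M w) (a * 1#) μ
    negated = F.trans (term-cong (ν ·M w) μ (F.sym (RingProperties.-‿distribʳ-* a 1#))) (term-neg (ν ·M w) (a * 1#) μ)

  coeff-·y^-·y^ : ∀ h r m μ → coeff ((h ·y^ r) ·y^ m) μ ≈ coeff (h ·y^ (r ·M m)) μ
  coeff-·y^-·y^ [] r m μ = F.refl
  coeff-·y^-·y^ ((a , ν) ∷ h) r m μ =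
    coeff-∷-cong ((h ·y^ r) ·y^ m) (h ·y^ (r ·M m)) μ (F.*-identityʳ (a * 1#)) (·M-assoc ν r m) (coeff-·y^-·y^ h r m μ)

  binomial-self : ∀ h u μ → coeff (h *P binomial u u) μ ≈ 0#
  binomial-self h u μ = F.trans (coeff-binomial h u u μ) (F.-‿inverseʳ _)

  telescope : ∀ h r m₁ m₂ t μ →
              coeff (h *P binomial (r ·M m₁) t) μ ≈
              coeff ((h ·y^ r) *P binomial m₁ m₂) μ + coeff (h *P binomial (r ·M m₂) t) μ
  telescope h r m₁ m₂ t μ = begin
    coeff (h *P binomial (r ·M m₁) t) μ
      ≈⟨ coeff-binomial h (r ·M m₁) t μ ⟩
    coeff (h ·y^ (r ·M m₁)) μ + - coeff (h ·y^ t) μ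
      ≈⟨ telescope-difference _ (coeff (h ·y^ (r ·M m₂)) μ) _ ⟩
    (coeff (h ·y^ (r ·M m₁)) μ + - coeff (h ·y^ (r ·M m₂)) μ) + (coeff (h ·y^ (r ·M m₂)) μ + - coeff (h ·y^ t) μ)
      ≈⟨ F.+-cong (F.+-cong (coeff-·y^-·y^ h r m₁ μ) (F.-‿cong (coeff-·y^-·y^ h r m₂ μ))) F.refl ⟨
    (coeff ((h ·y^ r) ·y^ m₁) μ + - coeff ((h ·y^ r) ·y^ m₂) μ) + (coeff (h ·y^ (r ·M m₂)) μ + - coeff (h ·y^ t) μ)
      ≈⟨ F.+-cong (coeff-binomial (h ·y^ r) m₁ m₂ μ) (coeff-binomial h (r ·M m₂) t μ) ⟨
    coeff ((h ·y^ r) *P binomial m₁ m₂) μ + coeff (h *P binomial (r ·M m₂) t) μ ∎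

  combination : List (Polynomial × Polynomial) → Polynomial
  combination hs = sumP (map (λ hg → proj₁ hg *P proj₂ hg) hs)

  combination-++ : ∀ hs hs′ μ → coeff (combination (hs ++ hs′)) μ ≈ coeff (combination hs) μ + coeff (combination hs′) μ
  combination-++ [] hs′ μ = F.sym (F.+-identityˡ _)
  combination-++ ((h , g) ∷ hs) hs′ μ = begin
    coeff ((h *P g) ++ combination (hs ++ hs′)) μ                       ≈⟨ coeff-++ (h *P g) _ μ ⟩
    coeff (h *P g) μ + coeff (combination (hs ++ hs′)) μ                ≈⟨ F.+-cong F.refl (combination-++ hs hs′ μ) ⟩
    coeff (h *P g) μ + (coeff (combination hs) μ + coeff (combination hs′) μ) ≈⟨ F.+-assoc _ _ _ ⟨
    (coeff (h *P g) μ + coeff (combination hs) μ) + coeff (combination hs′) μ ≈⟨ F.+-cong (coeff-++ (h *P g) _ μ) F.refl ⟨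
    coeff ((h *P g) ++ combination hs) μ + coeff (combination hs′) μ    ∎

  module _ {Gen : Polynomial → Set c} where

    ideal-resp : ∀ f g → f ≈P g → InIdeal Gen g → InIdeal Gen f
    ideal-resp f g f≈g (hs , gens , g≈) = hs , gens , λ μ → F.trans (f≈g μ) (g≈ μ)

    ideal-zero : ∀ f → (∀ μ → coeff f μ ≈ 0#) → InIdeal Gen f
    ideal-zero f f≈0 = [] , [] , f≈0

    ideal-generator : ∀ h g → InRing h → Gen g → InIdeal Gen (h *P g)
    ideal-generator h g h∈ring gen =
      (h , g) ∷ [] , (h∈ring , gen) ∷ [] , λ μ → F.sym (F.trans (coeff-++ (h *P g) [] μ) (F.+-identityʳ _))

    ideal-+ : ∀ f g → InIdeal Gen f → InIdeal Gen g → InIdeal Gen (f +P g)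
    ideal-+ f g (hs , gens , f≈) (hs′ , gens′ , g≈) = hs ++ hs′ , AllP.++⁺ gens gens′ , λ μ → begin
      coeff (f ++ g) μ                             ≈⟨ coeff-++ f g μ ⟩
      coeff f μ + coeff g μ                        ≈⟨ F.+-cong (f≈ μ) (g≈ μ) ⟩
      coeff (combination hs) μ + coeff (combination hs′) μ ≈⟨ combination-++ hs hs′ μ ⟨
      coeff (combination (hs ++ hs′)) μ            ∎

    ideal-sum : ∀ hs → All (λ hg → InIdeal Gen (proj₁ hg *P proj₂ hg)) hs → InIdeal Gen (combination hs)
    ideal-sum [] [] = ideal-zero [] (λ μ → F.refl)
    ideal-sum ((h , g) ∷ hs) (hg∈ ∷ hs∈) = ideal-+ (h *P g) (combination hs) hg∈ (ideal-sum hs hs∈)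

  inRing-·y^ : ∀ h u → InRing h → (∀ e → ¬ IsDomino R e → exponent u e ≡ 0) → InRing (h ·y^ u)
  inRing-·y^ [] u [] _ = []
  inRing-·y^ ((a , ν) ∷ h) u (ν-free ∷ h-free) u-free =
    (λ i j notDomino → Eq.trans (exponent-· ν u (i , j)) (cong₂ Nat._+_ (ν-free i j notDomino) (u-free (i , j) notDomino)))
    ∷ inRing-·y^ h u h-free u-free

  -- A flip path from T to T₂ through tilings puts h·(y^T − y^T₂) in the flip
  -- ideal: each flip T → T′ = K ∪ D₂ (with T = K ∪ D₁) contributes the term
  -- (h·y^K)·(y^D₁ − y^D₂), and the remaining difference is h·(y^T′ − y^T₂).
  flipPath-in-flipIdeal : ∀ {T T₂} h → InRing h → IsTiling R T → IsTiling R T₂ → FlipReach R T T₂ →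
                          InIdeal FlipGen (h *P (y^ T -P y^ T₂))
  flipPath-in-flipIdeal {T} {T₂} h h∈ring tiling tiling₂ (done same) = ideal-zero (h *P (y^ T -P y^ T₂)) λ μ → begin
    coeff (h *P binomial (monoOf T) (monoOf T₂)) μ  ≡⟨ cong (λ m → coeff (h *P binomial m (monoOf T₂)) μ) y^T≡y^T₂ ⟩
    coeff (h *P binomial (monoOf T₂) (monoOf T₂)) μ ≈⟨ binomial-self h (monoOf T₂) μ ⟩
    0#                                              ∎
    where
    y^T≡y^T₂ : monoOf T ≡ monoOf T₂
    y^T≡y^T₂ = monoOf-≡ T T₂ (sameSet⇒occ tiling tiling₂ same)
  flipPath-in-flipIdeal {T} {T₂} h h∈ring tiling tiling₂ (step (D₁ , D₂) flip tiling′ rest) =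
    ideal-resp (h *P (y^ T -P y^ T₂)) (flipTerm +P (h *P (y^ T′ -P y^ T₂))) split
      (ideal-+ flipTerm (h *P (y^ T′ -P y^ T₂))
        (ideal-generator (h ·y^ monoOf K) (y^ D₁ -P y^ D₂) (inRing-·y^ h (monoOf K) h∈ring K-free) (D₁ , D₂ , flip , refl))
        (flipPath-in-flipIdeal h h∈ring tiling′ tiling₂ rest))
    where
    open ApplyFlip (flipSquare flip) tiling using (T′; flip-step; flip-needs-D₁)
    K = kept D₁ T
    flipTerm = (h ·y^ monoOf K) *P (y^ D₁ -P y^ D₂)
    y^T≡ : monoOf T ≡ monoOf K ·M monoOf D₁
    y^T≡ = monoOf-split T K D₁ (proj₂ (flip-step (flip-needs-D₁ tiling′)))
    K-free : ∀ e → ¬ IsDomino R e → exponent (monoOf K) e ≡ 0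
    K-free e notDomino = Eq.trans (exponent-monoOf K e) (dominoes-occ e (AllP.filter⁺ _ (proj₁ tiling)) notDomino)
    split : (h *P (y^ T -P y^ T₂)) ≈P (flipTerm +P (h *P (y^ T′ -P y^ T₂)))
    split μ = begin
      coeff (h *P binomial (monoOf T) (monoOf T₂)) μ
        ≡⟨ cong (λ m → coeff (h *P binomial m (monoOf T₂)) μ) y^T≡ ⟩
      coeff (h *P binomial (monoOf K ·M monoOf D₁) (monoOf T₂)) μ
        ≈⟨ telescope h (monoOf K) (monoOf D₁) (monoOf D₂) (monoOf T₂) μ ⟩
      coeff ((h ·y^ monoOf K) *P binomial (monoOf D₁) (monoOf D₂)) μ + coeff (h *P binomial (monoOf K ·M monoOf D₂) (monoOf T₂)) μ
        ≡⟨ cong (λ m → coeff flipTerm μ + coeff (h *P binomial m (monoOf T₂)) μ) (Eq.sym (monoOf-++ K D₂)) ⟩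
      coeff flipTerm μ + coeff (h *P binomial (monoOf T′) (monoOf T₂)) μ
        ≈⟨ coeff-++ flipTerm (h *P (y^ T′ -P y^ T₂)) μ ⟨
      coeff (flipTerm +P (h *P (y^ T′ -P y^ T₂))) μ ∎

  flipConnected⇒tilingIdeal⊆flipIdeal : FlipConnected R → TilingIdeal⊆FlipIdeal
  flipConnected⇒tilingIdeal⊆flipIdeal connected f (hs , gens , f≈) =
    ideal-resp f (combination hs) f≈ (ideal-sum hs (All.map generator gens))
    where
    generator : ∀ {hg} → InRing (proj₁ hg) × TilingGen (proj₂ hg) → InIdeal FlipGen (proj₁ hg *P proj₂ hg)
    generator {h , _} (h∈ring , T₁ , T₂ , tiling₁ , tiling₂ , refl) =
      flipPath-in-flipIdeal h h∈ring tiling₁ tiling₂ (connected T₁ T₂ tiling₁ tiling₂)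

  -- It is a linear functional, so it vanishes on the flip ideal as soon as Cl
  -- never separates the two monomials of a flip binomial times a term.
  mass : List Mono → Polynomial → Carrier
  mass [] p = 0#
  mass (μ ∷ Cl) p = coeff p μ + mass Cl p

  mass-cong : ∀ Cl {p q} → p ≈P q → mass Cl p ≈ mass Cl q
  mass-cong [] p≈q = F.refl
  mass-cong (μ ∷ Cl) p≈q = F.+-cong (p≈q μ) (mass-cong Cl p≈q)

  mass-[] : ∀ Cl → mass Cl [] ≈ 0#
  mass-[] [] = F.refl
  mass-[] (μ ∷ Cl) = F.trans (F.+-identityˡ _) (mass-[] Cl)

  mass-++ : ∀ Cl p q → mass Cl (p ++ q) ≈ mass Cl p + mass Cl q
  mass-++ [] p q = F.sym (F.+-identityˡ 0#)
  mass-++ (μ ∷ Cl) p q = F.trans (F.+-cong (coeff-++ p q μ) (mass-++ Cl p q)) (interchange _ _ _ _)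

  term-same : ∀ ν a → term ν a ν ≈ a
  term-same ν a with ν ≟M ν
  ... | yes _   = F.refl
  ... | no ν≢ν  = ⊥-elim (ν≢ν refl)

  term-other : ∀ {ν μ} a → ν ≢ μ → term ν a μ ≈ 0#
  term-other {ν} {μ} a ν≢μ with ν ≟M μ
  ... | yes ν≡μ = ⊥-elim (ν≢μ ν≡μ)
  ... | no _    = F.refl

  mass-term-∉ : ∀ Cl {ν} a → ν ∉ Cl → mass Cl ((a , ν) ∷ []) ≈ 0#
  mass-term-∉ [] a ν∉Cl = F.refl
  mass-term-∉ (μ ∷ Cl) {ν} a ν∉Cl = begin
    coeff ((a , ν) ∷ []) μ + mass Cl ((a , ν) ∷ [])
      ≈⟨ F.+-cong (F.trans (coeff-∷ a ν [] μ) (F.+-identityʳ _)) (mass-term-∉ Cl a (ν∉Cl ∘ there)) ⟩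
    term ν a μ + 0#  ≈⟨ F.+-identityʳ _ ⟩
    term ν a μ       ≈⟨ term-other a (ν∉Cl ∘ here) ⟩
    0#               ∎

  mass-term-∈ : ∀ Cl {ν} a → Unique Cl → ν ∈ Cl → mass Cl ((a , ν) ∷ []) ≈ a
  mass-term-∈ (μ ∷ Cl) {ν} a (μ∉Cl ∷ unique) ν∈μCl = begin
    coeff ((a , ν) ∷ []) μ + mass Cl ((a , ν) ∷ [])
      ≈⟨ F.+-cong (F.trans (coeff-∷ a ν [] μ) (F.+-identityʳ _)) F.refl ⟩
    term ν a μ + mass Cl ((a , ν) ∷ []) ≈⟨ split ν∈μCl ⟩
    a                                   ∎
    where
    split : ν ∈ μ ∷ Cl → term ν a μ + mass Cl ((a , ν) ∷ []) ≈ a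
    split (here refl) = F.trans (F.+-cong (term-same ν a) (mass-term-∉ Cl a (λ ν∈Cl → All.lookup μ∉Cl ν∈Cl refl)))
                                (F.+-identityʳ a)
    split (there ν∈Cl) = F.trans (F.+-cong (term-other a (λ ν≡μ → All.lookup μ∉Cl ν∈Cl (Eq.sym ν≡μ)))
                                           (mass-term-∈ Cl a unique ν∈Cl))
                                 (F.+-identityˡ a)

  Balanced : List Mono → Mono → Mono → Polynomial → Set c
  Balanced Cl u w = All (λ t → (proj₂ t ·M u ∈ Cl → proj₂ t ·M w ∈ Cl) × (proj₂ t ·M w ∈ Cl → proj₂ t ·M u ∈ Cl))

  -- then h·(y^u − y^w) has mass 0, its terms cancelling in pairs
  mass-binomial : ∀ Cl → Unique Cl → ∀ h u w → Balanced Cl u w h → mass Cl (h *P binomial u w) ≈ 0#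
  mass-binomial Cl unique [] u w [] = mass-[] Cl
  mass-binomial Cl unique ((a , ν) ∷ h) u w ((u⇒w , w⇒u) ∷ balanced) = begin
    mass Cl (((a , ν) ∷ h) *P binomial u w)
      ≈⟨ F.trans (mass-++ Cl ((a * 1# , ν ·M u) ∷ []) _) (F.+-cong F.refl (mass-++ Cl ((a * - 1# , ν ·M w) ∷ []) _)) ⟩
    mass Cl ((a * 1# , ν ·M u) ∷ []) + (mass Cl ((a * - 1# , ν ·M w) ∷ []) + mass Cl (h *P binomial u w))
      ≈⟨ F.+-cong F.refl (F.+-cong F.refl (mass-binomial Cl unique h u w balanced)) ⟩
    mass Cl ((a * 1# , ν ·M u) ∷ []) + (mass Cl ((a * - 1# , ν ·M w) ∷ []) + 0#)
      ≈⟨ pair-cancels (ν ·M u ∈? Cl) ⟩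
    0# ∎
    where
    open import Data.List.Membership.DecPropositional _≟M_ using (_∈?_)
    pair-cancels : Dec (ν ·M u ∈ Cl) →
                   mass Cl ((a * 1# , ν ·M u) ∷ []) + (mass Cl ((a * - 1# , ν ·M w) ∷ []) + 0#) ≈ 0#
    pair-cancels (yes νu∈Cl) = F.trans
      (F.+-cong (mass-term-∈ Cl _ unique νu∈Cl)
                (F.+-cong (F.trans (mass-term-∈ Cl _ unique (u⇒w νu∈Cl)) (F.sym (RingProperties.-‿distribʳ-* a 1#))) F.refl))
      (cancel-pair (a * 1#) 0#)
    pair-cancels (no νu∉Cl) = F.trans
      (F.+-cong (mass-term-∉ Cl _ νu∉Cl) (F.+-cong (mass-term-∉ Cl _ (νu∉Cl ∘ w⇒u)) F.refl))
      (F.trans (F.+-identityˡ _) (F.+-identityˡ 0#))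

  FlipCertificate : List (Polynomial × Polynomial) → Set c
  FlipCertificate = All (λ hg → InRing (proj₁ hg) × FlipGen (proj₂ hg))

  -- A link of a certificate: a term y^ν of a multiplier of y^D₁ − y^D₂ joins
  -- the monomials ν·y^D₁ (its source) and ν·y^D₂ (its target).
  record Link : Set where
    constructor link
    field
      base     : Mono
      old new  : DominoSet R
      isFlip   : IsFlip R (old , new)

  source target : Link → Mono
  source l = Link.base l ·M monoOf (Link.old l)
  target l = Link.base l ·M monoOf (Link.new l)

  open BackwardClosure source target using (BackClosed)

  forward-links reverse-links : ∀ {D₁ D₂} → IsFlip R (D₁ , D₂) → Polynomial → List Link
  forward-links {D₁} {D₂} flip h = map (λ t → link (proj₂ t) D₁ D₂ flip) h
  reverse-links {D₁} {D₂} flip h = map (λ t → link (proj₂ t) D₂ D₁ (flip-reverse flip)) h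

  links : ∀ hs → FlipCertificate hs → List Link
  links [] [] = []
  links ((h , _) ∷ hs) ((_ , _ , _ , flip , _) ∷ certificate) =
    forward-links flip h ++ reverse-links flip h ++ links hs certificate

  balanced : ∀ Cl {D₁ D₂} (flip : IsFlip R (D₁ , D₂)) h →
             BackClosed Cl (forward-links flip h) → BackClosed Cl (reverse-links flip h) →
             Balanced Cl (monoOf D₁) (monoOf D₂) h
  balanced Cl flip [] _ _ = []
  balanced Cl flip (t ∷ h) closed-fwd closed-rev =
    (closed-rev (here refl) , closed-fwd (here refl))
    ∷ balanced Cl flip h (closed-fwd ∘ there) (closed-rev ∘ there)

  mass-certificate : ∀ Cl → Unique Cl → ∀ hs (certificate : FlipCertificate hs) →
                     BackClosed Cl (links hs certificate) → mass Cl (combination hs) ≈ 0#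
  mass-certificate Cl unique [] [] closed = mass-[] Cl
  mass-certificate Cl unique ((h , _) ∷ hs) ((_ , D₁ , D₂ , flip , refl) ∷ certificate) closed = begin
    mass Cl ((h *P (y^ D₁ -P y^ D₂)) ++ combination hs)
      ≈⟨ mass-++ Cl (h *P (y^ D₁ -P y^ D₂)) (combination hs) ⟩
    mass Cl (h *P (y^ D₁ -P y^ D₂)) + mass Cl (combination hs)
      ≈⟨ F.+-cong (mass-binomial Cl unique h (monoOf D₁) (monoOf D₂) (balanced Cl flip h closed-fwd closed-rev))
                  (mass-certificate Cl unique hs certificate closed-rest) ⟩
    0# + 0#
      ≈⟨ F.+-identityˡ 0# ⟩
    0# ∎
    where
    closed-fwd : BackClosed Cl (forward-links flip h)
    closed-fwd = closed ∘ ∈-++⁺ˡ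
    closed-rev : BackClosed Cl (reverse-links flip h)
    closed-rev = closed ∘ ∈-++⁺ʳ (forward-links flip h) ∘ ∈-++⁺ˡ
    closed-rest : BackClosed Cl (links hs certificate)
    closed-rest = closed ∘ ∈-++⁺ʳ (forward-links flip h) ∘ ∈-++⁺ʳ (reverse-links flip h)

  -- If y^T = y^ν·y^D₁ for a tiling T and a flip (D₁ , D₂), then D₁ ⊆ T, so the
  -- flip applies, and the flipped tiling has monomial y^ν·y^D₂.
  flip-on-monomial : ∀ {T ν D₁ D₂} → IsFlip R (D₁ , D₂) → IsTiling R T → monoOf T ≡ ν ·M monoOf D₁ →
                     IsTiling R (applyMove R T (D₁ , D₂)) × monoOf (applyMove R T (D₁ , D₂)) ≡ ν ·M monoOf D₂
  flip-on-monomial {T} {ν} {D₁} {D₂} flip tiling y^T≡ =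
    tiling′ , Eq.trans (monoOf-++ K D₂) (cong (_·M monoOf D₂) y^K≡ν)
    where
    open ApplyFlip (flipSquare flip) tiling using (flip-step)
    K = kept D₁ T
    occ-T : ∀ e → occ e T ≡ exponent ν e Nat.+ occ e D₁
    occ-T = monoOf-split⁻ T ν D₁ y^T≡
    D₁⊆T : All (_∈ T) D₁
    D₁⊆T = All.tabulate λ {d} d∈D₁ →
      occ⇒∈ d T (Eq.subst (1 Nat.≤_) (Eq.sym (occ-T d)) (ℕP.≤-trans (occ-∈ d∈D₁) (ℕP.m≤n+m _ (exponent ν d))))
    tiling′ = proj₁ (flip-step D₁⊆T)
    y^K≡ν : monoOf K ≡ ν
    y^K≡ν = mono-ext λ e → Eq.trans (exponent-monoOf K e)
      (ℕP.+-cancelʳ-≡ (occ e D₁) _ _ (Eq.trans (Eq.sym (proj₂ (flip-step D₁⊆T) e)) (occ-T e)))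

  tiling-binomial-in-ideal : ∀ {T₁ T₂} → IsTiling R T₁ → IsTiling R T₂ → InIdeal TilingGen (y^ T₁ -P y^ T₂)
  tiling-binomial-in-ideal {T₁} {T₂} tiling₁ tiling₂ =
    ideal-resp f (one *P f) (unit f)
      (ideal-generator one f ((λ i j _ → exponent-one (i , j)) ∷ []) (T₁ , T₂ , tiling₁ , tiling₂ , refl))
    where
    f = y^ T₁ -P y^ T₂
    one : Polynomial
    one = (1# , oneM) ∷ []
    unit : ∀ p → p ≈P (one *P p)
    unit [] μ = F.refl
    unit ((a , ν) ∷ p) μ = coeff-∷-cong p (one *P p) μ (F.sym (F.*-identityˡ a)) (Eq.sym (one-·M ν)) (unit p μ)

  -- (⇐) Let y^T₁ − y^T₂ = Σ h·(y^D₁ − y^D₂) be certified by hs.  The monomials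
  -- all of whose tilings reach T₂ by flips propagate backwards along the links
  -- of hs (flip-on-monomial), so they contain a duplicate-free back-closed Cl
  -- with y^T₂ ∈ Cl.  If y^T₁ were not in Cl, the mass of y^T₁ − y^T₂ on Cl
  -- would be −1, whereas the mass of the certified combination is 0.
  tilingIdeal⊆flipIdeal⇒flipConnected : TilingIdeal⊆FlipIdeal → FlipConnected R
  tilingIdeal⊆flipIdeal⇒flipConnected ideal⊆ T₁ T₂ tiling₁ tiling₂ =
    reach (ideal⊆ (y^ T₁ -P y^ T₂) (tiling-binomial-in-ideal tiling₁ tiling₂))
    where
    Good : Mono → Set
    Good μ = ∀ T → IsTiling R T → monoOf T ≡ μ → FlipReach R T T₂

    good₂ : Good (monoOf T₂)
    good₂ T _ y^T≡y^T₂ = done (occ⇒sameSet T T₂ (monoOf-≡⁻ T T₂ y^T≡y^T₂))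

    good-back : ∀ l → Good (target l) → Good (source l)
    good-back (link ν D₁ D₂ flip) good T tiling y^T≡ =
      let tiling′ , y^T′≡ = flip-on-monomial flip tiling y^T≡
      in step (D₁ , D₂) flip tiling′ (good _ tiling′ y^T′≡)

    open import Data.List.Membership.DecPropositional _≟M_ using (_∈?_)
    open BackwardClosure source target using (closure)

    reach : InIdeal FlipGen (y^ T₁ -P y^ T₂) → FlipReach R T₁ T₂
    reach (hs , certificate , f≈) with closure _≟M_ Good good-back (links hs certificate) good₂
    ... | record { Cl = Cl ; unique = unique ; good = good ; start = y^T₂∈Cl ; closed = closed } with monoOf T₁ ∈? Cl
    ...   | yes y^T₁∈Cl = All.lookup good y^T₁∈Cl T₁ tiling₁ refl
    ...   | no y^T₁∉Cl = ⊥-elim (1≉0 (RingProperties.-‿injective (F.trans -1≈0 (F.sym RingProperties.-0#≈0#))))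
      where
      -1≈0 : - 1# ≈ 0#
      -1≈0 = begin
        - 1#                                                                ≈⟨ F.+-identityˡ (- 1#) ⟨
        0# + - 1#                                                           ≈⟨ F.+-cong (mass-term-∉ Cl 1# y^T₁∉Cl)
                                                                                         (mass-term-∈ Cl (- 1#) unique y^T₂∈Cl) ⟨
        mass Cl ((1# , monoOf T₁) ∷ []) + mass Cl ((- 1# , monoOf T₂) ∷ []) ≈⟨ mass-++ Cl ((1# , monoOf T₁) ∷ []) _ ⟨
        mass Cl (y^ T₁ -P y^ T₂)                                            ≈⟨ mass-cong Cl f≈ ⟩
        mass Cl (combination hs)                                            ≈⟨ mass-certificate Cl unique hs certificate closed ⟩
        0#                                                                  ∎

mainTheorem6 : {c ℓ : Level} (𝕂 : Field c ℓ) (R : Region) →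
    FlipConnected R ⇔ Poly.TilingIdeal⊆FlipIdeal R 𝕂
mainTheorem6 𝕂 R = mk⇔ flipConnected⇒tilingIdeal⊆flipIdeal tilingIdeal⊆flipIdeal⇒flipConnected
  where open Polynomials R 𝕂
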